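{- Let $\mathcal{K}$ be a Kripke structure, let $\varphi$ be a HyperLTL formula of the form $\exists\pi_1\ldots\exists\pi_n.\forall\pi_{n+1}\ldots\forall\pi_{n+m}.\psi$ (an $\exists^*\forall^*$ formula), and let $\mathcal{A}_\psi$ be a deterministic parity automaton recognizing $\psi$. Then the coalition $\mathbb{P}_\exists=\{1,\ldots,n\}$ wins the multiplayer game $\mathcal{G}_{\mathcal{K},\varphi}$ (defined in the context) if and only if $\mathcal{K}\models\varphi$.
   Context: Kripke structure $\mathcal{K}=(S,s_\mathit{init},\mathbb{D},\kappa,\ell)$ over finite $\mathit{AP}$: finite $S$, initial state $s_\mathit{init}\notin S$, finite directions $\mathbb{D}$, $\kappa:(S\uplus\{s_\mathit{init}\})\times\mathbb{D}\to S$, $\ell:(S\uplus\{s_\mathit{init}\})\to2^{\mathit{AP}}$. Paths start in $s_\mathit{init}$ and follow $\kappa$ along some direction each step; $\mathit{Traces}(\mathcal{K})$ is the set of label sequences of paths. In a HyperLTL formula $\mathds{Q}_1\pi_1\ldots\mathds{Q}_N\pi_N.\psi$, $\psi$ is an LTL formula over $\mathit{AP}_\psi=\{a_{\pi_i}\mid a\in\mathit{AP},1\le i\le N\}$, evaluated on traces $t_1,\ldots,t_N$ via the word $w(j)=\bigcup_i\{a_{\pi_i}\mid a\in t_i(j)\}$; $\mathcal{K}\models\varphi$ uses standard first-order semantics with quantifiers ranging over $\mathit{Traces}(\mathcal{K})$. A DPA $\mathcal{A}_\psi=(2^{\mathit{AP}_\psi},Q_\psi,q_{0,\psi},\delta_\psi,c_\psi)$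 is deterministic with parity acceptance (minimal color seen infinitely often even) and accepts exactly the words satisfying $\psi$. MPG$_{ii}$ $(\mathbb{P},\{V_p\},v_\mathit{init},\mathbb{D},E,\{\sim_p\},c)$: disjoint vertex sets $V_p$ owned by players $p$, $E:V\times\mathbb{D}\to V$, equivalences $\sim_p$, coloring $c$. A strategy $\sigma_p:V^*\cdot V_p\to\mathbb{D}$ must agree on finite plays of equal length that are pointwise $\sim_p$-related; strategies of all players determine a unique play from $v_\mathit{init}$ (the owner of the current vertex chooses the direction). Coalition $A$ wins if there are strategies for $A$ such that for all strategies of the other players the resulting play is even (minimal color seen infinitely often is even). The game $\mathcal{G}_{\mathcal{K},\varphi}$ for $\varphi$ with $N$ trace variables: players $\{1,\ldots,N\}$; $V_p=\{\langle s_1,\ldots,s_N,q,p\rangle\mid s_i\in S\uplus\{s_\mathit{init}\},q\in Q_\psi\}$; $v_\mathit{init}=\langle s_\mathit{init},\ldots,s_\mathit{init},q_{0,\psi},1\rangle$; $\mathit{nxt}(p)=p+1$ for $p<N$, $\mathit{nxt}(N)=1$; for $p>1$, $E(\langle s_1,\ldots,s_N,q,p\rangle,d)$ replaces $s_p$ by $\kappa(s_p,d)$ and the owner by $\mathit{nxt}(p)$; $E(\langle s_1,\ldots,s_N,q,1\rangle,d)=\langle\kappa(s_1,d),s_2,\ldots,s_N,\delta_\psi(q,\bigcup_{i=1}^N\{a_{\pi_i}\mid a\in\ell(s_i)\}),\mathit{nxt}(1)\rangle$; $\langle s_1,\ldots,s_N,q,p'\rangle\sim_p\langle s'_1,\ldots,s'_N,q',p''\rangle$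 iff $p'=p''$ and $s_j=s'_j$ for all $j\le p$; color $c_\psi(q)$. Here $N=n+m$. -}

module Defs where

open import Data.Nat using (ℕ; zero; suc; _+_; _≤_; _<_; _<?_)
open import Data.Nat.Divisibility using (_∣_)
open import Data.Fin using (Fin; toℕ; fromℕ<)
open import Data.Fin.Subset using (Subset; _∈_)
open import Data.Maybe using (Maybe; nothing; just)
open import Data.Vec using (Vec; []; _∷_; lookup; replicate; _++_; _[_]≔_)
open import Data.List using (List; [_]) renaming (_++_ to _++ˡ_; [] to []ˡ)
open import Data.List.Relation.Binary.Pointwise using (Pointwise)
open import Data.Bool using (Bool; true; false; T; not; if_then_else_)
open import Data.Unit using (⊤)
open import Data.Product using (Σ; ∃; _×_; _,_; proj₁; proj₂)
open import Data.Sum using (_⊎_)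
open import Relation.Nullary using (¬_; yes; no)
open import Relation.Nullary.Decidable using (⌊_⌋)
open import Relation.Binary.PropositionalEquality using (_≡_)

InfOften : (ℕ → ℕ) → ℕ → Set
InfOften f c = ∀ i → ∃ λ j → i ≤ j × f j ≡ c

MinInfEven : (ℕ → ℕ) → Set
MinInfEven f = ∃ λ c → (2 ∣ c) × InfOften f c × (∀ c' → c' < c → ¬ InfOften f c')

-- Kripke structures over AP = Fin nAP.
-- States S = Fin nS; the extra initial state s_init is `nothing`,
-- so S ⊎ {s_init} = Maybe (Fin nS).  Directions 𝔻 = Fin nD.

record Kripke (nAP : ℕ) : Set where
  field
    nS : ℕ
    nD : ℕ
    κ  : Maybe (Fin nS) → Fin nD → Fin nS
    ℓ  : Maybe (Fin nS) → Subset nAP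

Trace : ℕ → Set
Trace nAP = ℕ → Subset nAP

IsPath : ∀ {nAP} (K : Kripke nAP) → (ℕ → Maybe (Fin (Kripke.nS K))) → Set
IsPath K ρ = (ρ 0 ≡ nothing) × (∀ i → ∃ λ d → ρ (suc i) ≡ just (Kripke.κ K (ρ i) d))

IsTrace : ∀ {nAP} (K : Kripke nAP) → Trace nAP → Set
IsTrace K t = ∃ λ ρ → IsPath K ρ × (∀ i → t i ≡ Kripke.ℓ K (ρ i))

-- LTL over AP_ψ = { a_{π_i} | a ∈ AP, i ∈ {1..N} } (π_i ↔ Fin N index i-1).
-- A letter of 2^{AP_ψ} is represented as Fin N → Subset nAP
-- (a_{π_i} ∈ σ  iff  a ∈ σ i).

Letter : ℕ → ℕ → Set
Letter N nAP = Fin N → Subset nAP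

data LTL (N nAP : ℕ) : Set where
  tt    : LTL N nAP
  atom  : Fin nAP → Fin N → LTL N nAP
  ¬'_   : LTL N nAP → LTL N nAP
  _∧'_  : LTL N nAP → LTL N nAP → LTL N nAP
  X'_   : LTL N nAP → LTL N nAP
  _U'_  : LTL N nAP → LTL N nAP → LTL N nAP

_,_⊨_ : ∀ {N nAP} → (ℕ → Letter N nAP) → ℕ → LTL N nAP → Set
w , j ⊨ tt = ⊤
w , j ⊨ atom a i = a ∈ w j i
w , j ⊨ (¬' φ) = ¬ (w , j ⊨ φ)
w , j ⊨ (φ ∧' χ) = (w , j ⊨ φ) × (w , j ⊨ χ)
w , j ⊨ (X' φ) = w , suc j ⊨ φ
w , j ⊨ (φ U' χ) = ∃ λ k → j ≤ k × (w , k ⊨ χ) × (∀ i → j ≤ i → i < k → w , i ⊨ φ)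

record DPA (Σ' : Set) : Set where
  field
    nQ : ℕ
    q₀ : Fin nQ
    δ  : Fin nQ → Σ' → Fin nQ
    c  : Fin nQ → ℕ

  run : (ℕ → Σ') → ℕ → Fin nQ
  run w zero    = q₀
  run w (suc k) = δ (run w k) (w k)

  Accepts : (ℕ → Σ') → Set
  Accepts w = MinInfEven (λ k → c (run w k))

Recognizes : ∀ {N nAP} → DPA (Letter N nAP) → LTL N nAP → Set
Recognizes A ψ = ∀ w → (DPA.Accepts A w → w , 0 ⊨ ψ) × (w , 0 ⊨ ψ → DPA.Accepts A w)

data Quant : Set where
  ∃q ∀q : Quant

record HyperLTL (N nAP : ℕ) : Set where
  constructor _·_
  field
    prefix : Vec Quant N
    body   : LTL N nAP

zipTraces : ∀ {N nAP} → Vec (Trace nAP) N → ℕ → Letter N nAP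
zipTraces ts j i = lookup ts i j

SatPrefix : ∀ {nAP k} (K : Kripke nAP) → Vec Quant k → (Vec (Trace nAP) k → Set) → Set
SatPrefix K [] P = P []
SatPrefix K (∃q ∷ qs) P = ∃ λ t → IsTrace K t × SatPrefix K qs (λ ts → P (t ∷ ts))
SatPrefix K (∀q ∷ qs) P = ∀ t → IsTrace K t → SatPrefix K qs (λ ts → P (t ∷ ts))

_⊨ᴴ_ : ∀ {nAP N} → Kripke nAP → HyperLTL N nAP → Set
K ⊨ᴴ (qs · ψ) = SatPrefix K qs (λ ts → zipTraces ts , 0 ⊨ ψ)

∃∀-formula : ∀ {nAP} n m → LTL (n + m) nAP → HyperLTL (n + m) nAP
∃∀-formula n m ψ = (replicate n ∃q ++ replicate m ∀q) · ψ

-- Multiplayer games with imperfect information (MPG_ii).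
-- Players ℙ = Fin N (player p+1 ↔ index p); V_p = { v | owner v ≡ p }.

record MPG (N : ℕ) : Set₁ where
  field
    V     : Set
    owner : V → Fin N
    vinit : V
    nD    : ℕ
    E     : V → Fin nD → V
    _∼[_]_ : V → Fin N → V → Set
    color : V → ℕ

  -- a finite play  h · v  (h ∈ V*, v ∈ V) is represented by the pair (h , v).
  -- Strategies are defined on plays ending in V_p and must agree on
  -- pointwise ∼_p-related plays of equal length.
  Strategy : Fin N → Set
  Strategy p = Σ (List V → V → Fin nD) λ σ →
    ∀ h h' v v' → owner v ≡ p → owner v' ≡ p →
      Pointwise (λ x y → x ∼[ p ] y) h h' → v ∼[ p ] v' → σ h v ≡ σ h' v'

  history : ((p : Fin N) → Strategy p) → ℕ → List V × V
  history σ zero = []ˡ , vinit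
  history σ (suc k) with history σ k
  ... | h , v = (h ++ˡ [ v ]) , E v (proj₁ (σ (owner v)) h v)

  play : ((p : Fin N) → Strategy p) → ℕ → V
  play σ k = proj₂ (history σ k)

  Even : (ℕ → V) → Set
  Even π = MinInfEven (λ k → color (π k))

  pick : ∀ {X : Set} (b : Bool) → (T b → X) → (T (not b) → X) → X
  pick true  f g = f _
  pick false f g = g _

  Wins : (Fin N → Bool) → Set
  Wins A = Σ ((p : Fin N) → T (A p) → Strategy p) λ σA →
           ∀ (σB : (p : Fin N) → T (not (A p)) → Strategy p) →
             Even (play (λ p → pick (A p) (σA p) (σB p)))

module _ {nAP : ℕ} (K : Kripke nAP) {N : ℕ} (A : DPA (Letter N nAP)) (N>0 : 0 < N) where
  open Kripke K
  open DPA A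

  player₁ : Fin N
  player₁ = fromℕ< N>0

  nxt : Fin N → Fin N
  nxt p with suc (toℕ p) <? N
  ... | yes h = fromℕ< h
  ... | no _  = player₁

  GVertex : Set
  GVertex = Vec (Maybe (Fin nS)) N × Fin nQ × Fin N

  gLetter : Vec (Maybe (Fin nS)) N → Letter N nAP
  gLetter ss i = ℓ (lookup ss i)

  gE : GVertex → Fin nD → GVertex
  gE (ss , q , p) d =
    (ss [ p ]≔ just (κ (lookup ss p) d)) ,
    (if ⌊ toℕ p Data.Nat.≟ 0 ⌋ then δ q (gLetter ss) else q) ,
    nxt p

  gSim : GVertex → Fin N → GVertex → Set
  gSim (ss , q , p') p (ss' , q' , p'') =
    (p' ≡ p'') × (∀ j → toℕ j ≤ toℕ p → lookup ss j ≡ lookup ss' j)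

  Game : MPG N
  Game = record
    { V      = GVertex
    ; owner  = λ v → proj₂ (proj₂ v)
    ; vinit  = replicate N nothing , q₀ , player₁
    ; nD     = nD
    ; E      = gE
    ; _∼[_]_ = gSim
    ; color  = λ v → c (proj₁ (proj₂ v))
    }

ℙ∃ : ∀ {N} → ℕ → Fin N → Bool
ℙ∃ n p = ⌊ toℕ p <? n ⌋

-- In round r of a play the players move in turn, player p extending the p-th path through the
-- Kripke structure by one step, and at the first move of the round the automaton component reads
-- the letter formed by the current states of all N paths. So the colours of a play are those of the
-- run of A_ψ on the word of its N paths, each repeated N times: the play is even iff the paths satisfy ψ.
-- Player p observes only the states of players 1 … p, so the paths of the existential players do not
-- depend on the universal players: a winning coalition strategy fixes witnesses π_1 … π_n that work
-- against all universal traces. Conversely, witnesses are realised by blind strategies following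
-- their paths, and whatever the universal players do, they trace out paths of the structure.
module Submission where

open import Defs
open import Data.Nat using (ℕ; zero; suc; pred; _+_; _*_; _≤_; _<_; _≟_; _<?_; NonZero; >-nonZero; s≤s⁻¹)
open import Data.Nat.Properties
  using (≤-refl; ≤-trans; ≤-antisym; ≤-reflexive; ≤-<-trans; <-trans; <⇒≤; <⇒≢; ≮⇒≥; ≤∧≢⇒<; n≤1+n; 0≢1+n;
         +-comm; +-suc; +-identityʳ; +-monoʳ-≤; m≤m*n; *-cancelʳ-≤; suc-pred)
open import Data.Nat.DivMod
  using (_/_; _%_; m≡m%n+[m/n]*n; n%n≡0; [m+kn]%n≡m%n; m%n<n; m<n⇒m%n≡m; m*n%n≡0;
         m*n/n≡m; m<n⇒m/n≡0; +-distrib-/-∣ˡ)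
open import Data.Nat.Divisibility using (divides-refl)
open import Data.Bool using (T; not)
open import Data.Fin using (Fin; toℕ; fromℕ<; reduce≥; _↑ˡ_)
open import Data.Fin.Properties using (toℕ-injective; toℕ-fromℕ<; toℕ-↑ˡ; toℕ<n)
import Data.Fin.Properties as Fin
open import Data.Fin.Subset using (_∈_)
open import Data.Maybe using (Maybe; nothing; just)
open import Data.List using (List; []; length)
open import Data.List.Properties using (length-++)
open import Data.List.Relation.Binary.Pointwise using (Pointwise; []; _∷_; ++⁺; Pointwise-length)
import Data.List.Relation.Binary.Pointwise as Pointwise
open import Data.Vec using (Vec; []; _∷_; _++_; lookup; replicate; tabulate; take; drop; _[_]≔_)
open import Data.Vec.Properties
  using (lookup∘update; lookup∘update′; lookup-replicate; lookup-++-<; lookup-++-≥; lookup∘tabulate; take++drop≡id)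
open import Data.Vec.Relation.Unary.All using (All; []; _∷_)
open import Data.Vec.Relation.Unary.All.Properties using (lookup⁺; tabulate⁺; drop⁺)
open import Data.Product using (∃; _×_; _,_; proj₁; proj₂)
open import Function.Bundles using (_⇔_; mk⇔; Equivalence)
import Function.Properties.Equivalence as ⇔
open import Relation.Nullary using (Dec; yes; no; ¬_; contradiction)
open import Relation.Nullary.Decidable using (⌊_⌋; fromWitness; toWitness; fromWitnessFalse; toWitnessFalse)
open import Relation.Binary.PropositionalEquality
  using (_≡_; _≢_; refl; sym; trans; cong; cong₂; subst; module ≡-Reasoning)

open Equivalence using (to; from)
open ≡-Reasoning

[m*n+o]/n≡m : ∀ m n {o} .{{_ : NonZero n}} → o < n → (m * n + o) / n ≡ m
[m*n+o]/n≡m m n {o} o<n = begin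
  (m * n + o) / n   ≡⟨ +-distrib-/-∣ˡ o (divides-refl m) ⟩
  m * n / n + o / n ≡⟨ cong₂ _+_ (m*n/n≡m m n) (m<n⇒m/n≡0 o<n) ⟩
  m + 0             ≡⟨ +-identityʳ m ⟩
  m                 ∎

lookup∘update-agree : ∀ {A : Set} {k} (P : Fin k → Set) {xs ys : Vec A k} {p p' x y} →
                      p ≡ p' → (P p → x ≡ y) → (∀ i → P i → lookup xs i ≡ lookup ys i) →
                      ∀ i → P i → lookup (xs [ p ]≔ x) i ≡ lookup (ys [ p' ]≔ y) i
lookup∘update-agree P {xs} {ys} {p} refl x≡y xs≡ys i Pi with i Fin.≟ p
... | yes refl = trans (lookup∘update i xs _) (trans (x≡y Pi) (sym (lookup∘update i ys _)))
... | no  i≢p  = trans (lookup∘update′ i≢p xs _) (trans (xs≡ys i Pi) (sym (lookup∘update′ i≢p ys _)))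

fromℕ<-↑ˡ : ∀ {n} m {p : Fin (n + m)} (p<n : toℕ p < n) → fromℕ< p<n ↑ˡ m ≡ p
fromℕ<-↑ˡ m {p} p<n = toℕ-injective (trans (toℕ-↑ˡ (fromℕ< p<n) m) (toℕ-fromℕ< p<n))

lookup-++-drop : ∀ {A : Set} {n m} (xs : Vec A n) (ys : Vec A (n + m)) p → n ≤ toℕ p →
                 lookup (xs ++ drop n ys) p ≡ lookup ys p
lookup-++-drop {n = n} xs ys p n≤p = begin
  lookup (xs ++ drop n ys) p          ≡⟨ lookup-++-≥ xs (drop n ys) p n≤p ⟩
  lookup (drop n ys) (reduce≥ p n≤p)  ≡⟨ lookup-++-≥ (take n ys) (drop n ys) p n≤p ⟨
  lookup (take n ys ++ drop n ys) p   ≡⟨ cong (λ zs → lookup zs p) (take++drop≡id n ys) ⟩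
  lookup ys p                         ∎

⊨-cong : ∀ {N nAP} {w w' : ℕ → Letter N nAP} → (∀ j i → w j i ≡ w' j i) →
         ∀ φ j → w , j ⊨ φ → w' , j ⊨ φ
⊨-cong w≗w' tt         j _                   = _
⊨-cong w≗w' (atom a i) j a∈                  = subst (a ∈_) (w≗w' j i) a∈
⊨-cong w≗w' (¬' φ)     j ¬φ                  = λ φ' → ¬φ (⊨-cong (λ j i → sym (w≗w' j i)) φ j φ')
⊨-cong w≗w' (φ ∧' χ)   j (φ₁ , χ₁)           = ⊨-cong w≗w' φ j φ₁ , ⊨-cong w≗w' χ j χ₁
⊨-cong w≗w' (X' φ)     j φ₁                  = ⊨-cong w≗w' φ (suc j) φ₁
⊨-cong w≗w' (φ U' χ)   j (k , j≤k , χₖ , φ<) =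
  k , j≤k , ⊨-cong w≗w' χ k χₖ , λ i j≤i i<k → ⊨-cong w≗w' φ i (φ< i j≤i i<k)

MinInfEven-cong : ∀ {f g} → (∀ c → InfOften f c ⇔ InfOften g c) → MinInfEven f ⇔ MinInfEven g
MinInfEven-cong io⇔ = mk⇔ (transfer io⇔) (transfer (λ c → ⇔.sym (io⇔ c)))
  where
  transfer : ∀ {f g} → (∀ c → InfOften f c ⇔ InfOften g c) → MinInfEven f → MinInfEven g
  transfer io⇔ (c , 2∣c , io , minimal) =
    c , 2∣c , to (io⇔ c) io , λ c' c'<c io' → minimal c' c'<c (from (io⇔ c') io')

InfOften-slowdown : ∀ N .{{_ : NonZero N}} {f g : ℕ → ℕ} →
                    (∀ r → f (r * N) ≡ g r) → (∀ k → ∃ λ r → k ≤ r * N × f k ≡ g r) →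
                    ∀ c → InfOften f c ⇔ InfOften g c
InfOften-slowdown N {f} {g} sample catch-up c = mk⇔ slow fast
  where
  slow : InfOften f c → InfOften g c
  slow io i =
    let k , iN≤k , fk≡c = io (i * N)
        r , k≤rN , fk≡gr = catch-up k
    in  r , *-cancelʳ-≤ i r N (≤-trans iN≤k k≤rN) , trans (sym fk≡gr) fk≡c
  fast : InfOften g c → InfOften f c
  fast io i =
    let r , i≤r , gr≡c = io i
    in  r * N , ≤-trans i≤r (m≤m*n r N) , trans (sample r) gr≡c

module _ {nAP} (K : Kripke nAP) where
  open Kripke K

  walk : (ℕ → Fin nD) → ℕ → Maybe (Fin nS)
  walk D zero    = nothing
  walk D (suc r) = just (κ (walk D r) (D r))

  path≗walk : ∀ {ρ} (ρ-path : IsPath K ρ) → ∀ r → ρ r ≡ walk (λ i → proj₁ (proj₂ ρ-path i)) r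
  path≗walk (ρ₀ , ρ-step) zero    = ρ₀
  path≗walk (ρ₀ , ρ-step) (suc r) =
    trans (proj₂ (ρ-step r)) (cong (λ s → just (κ s _)) (path≗walk (ρ₀ , ρ-step) r))

  trace⇒walk : ∀ {t} → IsTrace K t → ∃ λ D → ∀ r → t r ≡ ℓ (walk D r)
  trace⇒walk (ρ , ρ-path , t≗ℓρ) = _ , λ r → trans (t≗ℓρ r) (cong ℓ (path≗walk ρ-path r))

  SatPrefix-∀* : ∀ m (P : Vec (Trace nAP) m → Set) →
                 SatPrefix K (replicate m ∀q) P ⇔ (∀ ts → All (IsTrace K) ts → P ts)
  SatPrefix-∀* zero    P = mk⇔ (λ { sat [] [] → sat }) (λ all → all [] [])
  SatPrefix-∀* (suc m) P = mk⇔
    (λ { sat (t ∷ ts) (tr ∷ trs) → to (SatPrefix-∀* m _) (sat t tr) ts trs })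
    (λ all t tr → from (SatPrefix-∀* m _) (λ ts trs → all (t ∷ ts) (tr ∷ trs)))

  SatPrefix-∃*++ : ∀ n {k} (qs : Vec Quant k) (P : Vec (Trace nAP) (n + k) → Set) →
                   SatPrefix K (replicate n ∃q ++ qs) P ⇔
                   ∃ λ ts₁ → All (IsTrace K) ts₁ × SatPrefix K qs (λ ts₂ → P (ts₁ ++ ts₂))
  SatPrefix-∃*++ zero    qs P = mk⇔ (λ sat → [] , [] , sat) (λ { ([] , [] , sat) → sat })
  SatPrefix-∃*++ (suc n) qs P = mk⇔
    (λ (t , tr , sat) → let ts₁ , trs , sat' = to (SatPrefix-∃*++ n qs _) sat in t ∷ ts₁ , tr ∷ trs , sat')
    (λ { (t ∷ ts₁ , tr ∷ trs , sat) → t , tr , from (SatPrefix-∃*++ n qs _) (ts₁ , trs , sat) })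

  ∃∀-Sat : ∀ n m → LTL (n + m) nAP → Set
  ∃∀-Sat n m ψ = ∃ λ (ts₁ : Vec (Trace nAP) n) → All (IsTrace K) ts₁ ×
                   ∀ (ts₂ : Vec (Trace nAP) m) → All (IsTrace K) ts₂ → zipTraces (ts₁ ++ ts₂) , 0 ⊨ ψ

  ⊨-∃∀ : ∀ n m (ψ : LTL (n + m) nAP) → K ⊨ᴴ ∃∀-formula n m ψ ⇔ ∃∀-Sat n m ψ
  ⊨-∃∀ n m ψ = mk⇔
    (λ sat → let ts₁ , trs , sat' = to (SatPrefix-∃*++ n _ _) sat in ts₁ , trs , to (SatPrefix-∀* m _) sat')
    (λ (ts₁ , trs , all) → from (SatPrefix-∃*++ n _ _) (ts₁ , trs , from (SatPrefix-∀* m _) all))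

module _ {nAP} (K : Kripke nAP) {N} (Aψ : DPA (Letter N nAP)) (N>0 : 0 < N) where
  open Kripke K using (nS; nD; κ; ℓ)
  open DPA Aψ using (nQ; δ; run; Accepts; c)
  open MPG (Game K Aψ N>0) using (Strategy; history; play; Even)

  private instance
    N≢0 : NonZero N
    N≢0 = >-nonZero N>0

  Profile : Set
  Profile = (p : Fin N) → Strategy p

  -- Ignores all observations; a history of length r * N + p belongs to round r.
  blind : (p : Fin N) → (ℕ → Fin nD) → Strategy p
  blind p D = (λ h _ → D (length h / N)) ,
              λ h h' _ _ _ _ h∼h' _ → cong (λ l → D (l / N)) (Pointwise-length h∼h')

  toℕ-nxt : ∀ p → toℕ (nxt K Aψ N>0 p) ≡ suc (toℕ p) % N
  toℕ-nxt p with suc (toℕ p) <? N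
  ... | yes p+1<N = trans (toℕ-fromℕ< p+1<N) (sym (m<n⇒m%n≡m p+1<N))
  ... | no  p+1≮N = begin
    toℕ (fromℕ< N>0)  ≡⟨ toℕ-fromℕ< N>0 ⟩
    0                 ≡⟨ sym (n%n≡0 N) ⟩
    N % N             ≡⟨ cong (_% N) (sym p+1≡N) ⟩
    suc (toℕ p) % N   ∎
    where
    p+1≡N : suc (toℕ p) ≡ N
    p+1≡N = ≤-antisym (toℕ<n p) (≮⇒≥ p+1≮N)

  module Play (σ : Profile) where
    positions : ℕ → Vec (Maybe (Fin nS)) N
    positions k = proj₁ (play σ k)

    autState : ℕ → Fin nQ
    autState k = proj₁ (proj₂ (play σ k))

    turn : ℕ → Fin N
    turn k = proj₂ (proj₂ (play σ k))

    past : ℕ → List (GVertex K Aψ N>0)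
    past k = proj₁ (history σ k)

    move : ℕ → Fin nD
    move k = proj₁ (σ (turn k)) (past k) (play σ k)

    -- Step r * N + toℕ p of a play is player p's move in round r, and state p r is the paper's s_p
    -- at the start of round r.
    state : Fin N → ℕ → Maybe (Fin nS)
    state p r = lookup (positions (r * N)) p

    moveOf : Fin N → ℕ → Fin nD
    moveOf p r = move (r * N + toℕ p)

    word : ℕ → Letter N nAP
    word r = gLetter K Aψ N>0 (positions (r * N))

    traceOf : Fin N → Trace nAP
    traceOf p r = ℓ (state p r)

    toℕ-turn : ∀ k → toℕ (turn k) ≡ k % N
    toℕ-turn zero    = trans (toℕ-fromℕ< N>0) (sym (m<n⇒m%n≡m N>0))
    toℕ-turn (suc k) = begin
      toℕ (nxt K Aψ N>0 (turn k)) ≡⟨ toℕ-nxt (turn k) ⟩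
      suc (toℕ (turn k)) % N      ≡⟨ cong (λ j → suc j % N) (toℕ-turn k) ⟩
      suc (k % N) % N             ≡⟨ sym ([m+kn]%n≡m%n (suc (k % N)) (k / N) N) ⟩
      suc (k % N + k / N * N) % N ≡⟨ cong (λ j → suc j % N) (sym (m≡m%n+[m/n]*n k N)) ⟩
      suc k % N                   ∎

    turn-in-round : ∀ r j → j < N → toℕ (turn (r * N + j)) ≡ j
    turn-in-round r j j<N = begin
      toℕ (turn (r * N + j)) ≡⟨ toℕ-turn (r * N + j) ⟩
      (r * N + j) % N        ≡⟨ cong (_% N) (+-comm (r * N) j) ⟩
      (j + r * N) % N        ≡⟨ [m+kn]%n≡m%n j r N ⟩
      j % N                  ≡⟨ m<n⇒m%n≡m j<N ⟩
      j                      ∎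

    turn-moveOf : ∀ p r → turn (r * N + toℕ p) ≡ p
    turn-moveOf p r = toℕ-injective (turn-in-round r (toℕ p) (toℕ<n p))

    length-past : ∀ k → length (past k) ≡ k
    length-past zero    = refl
    length-past (suc k) = trans (length-++ (past k)) (trans (cong (_+ 1) (length-past k)) (+-comm k 1))

    moveOf-blind : ∀ {p D} → σ p ≡ blind p D → ∀ r → moveOf p r ≡ D r
    moveOf-blind {p} {D} σp≡blind r = begin
      proj₁ (σ (turn k)) (past k) (play σ k) ≡⟨ cong (λ q → proj₁ (σ q) (past k) (play σ k)) (turn-moveOf p r) ⟩
      proj₁ (σ p) (past k) (play σ k)        ≡⟨ cong (λ s → proj₁ s (past k) (play σ k)) σp≡blind ⟩
      D (length (past k) / N)                ≡⟨ cong (λ l → D (l / N)) (length-past k) ⟩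
      D (k / N)                              ≡⟨ cong D ([m*n+o]/n≡m r N (toℕ<n p)) ⟩
      D r                                    ∎
      where
      k : ℕ
      k = r * N + toℕ p

    positions-turn : ∀ k → lookup (positions (suc k)) (turn k) ≡
                           just (κ (lookup (positions k) (turn k)) (move k))
    positions-turn k = lookup∘update (turn k) (positions k) _

    positions-other : ∀ k {i} → i ≢ turn k → lookup (positions (suc k)) i ≡ lookup (positions k) i
    positions-other k i≢turn = lookup∘update′ i≢turn (positions k) _

    positions-waiting : ∀ r j {i} → j ≤ toℕ i → lookup (positions (r * N + j)) i ≡ state i r
    positions-waiting r zero    {i} _   = cong (λ k → lookup (positions k) i) (+-identityʳ (r * N))
    positions-waiting r (suc j) {i} j<i = begin
      lookup (positions (r * N + suc j)) i   ≡⟨ cong (λ k → lookup (positions k) i) (+-suc (r * N) j) ⟩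
      lookup (positions (suc (r * N + j))) i ≡⟨ positions-other (r * N + j) i≢turn ⟩
      lookup (positions (r * N + j)) i       ≡⟨ positions-waiting r j (≤-trans (n≤1+n j) j<i) ⟩
      state i r                              ∎
      where
      i≢turn : i ≢ turn (r * N + j)
      i≢turn i≡turn = <⇒≢ j<i (sym (trans (cong toℕ i≡turn) (turn-in-round r j (<-trans j<i (toℕ<n i)))))

    positions-moved : ∀ r j {i} → toℕ i < j → j ≤ N →
                      lookup (positions (r * N + j)) i ≡ just (κ (state i r) (moveOf i r))
    positions-moved r (suc j) {i} i<1+j j<N with toℕ i ≟ j
    ... | yes i≡j = begin
      lookup (positions (r * N + suc j)) i                ≡⟨ cong (λ k → lookup (positions k) i) (+-suc (r * N) j) ⟩
      lookup (positions (suc k)) i                        ≡⟨ cong (lookup (positions (suc k))) i≡turn ⟩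
      lookup (positions (suc k)) (turn k)                 ≡⟨ positions-turn k ⟩
      just (κ (lookup (positions k) (turn k)) (move k))   ≡⟨ cong₂ (λ s d → just (κ s d)) s≡ d≡ ⟩
      just (κ (state i r) (moveOf i r))                   ∎
      where
      k : ℕ
      k = r * N + j
      i≡turn : i ≡ turn k
      i≡turn = toℕ-injective (trans i≡j (sym (turn-in-round r j j<N)))
      s≡ : lookup (positions k) (turn k) ≡ state i r
      s≡ = trans (cong (lookup (positions k)) (sym i≡turn)) (positions-waiting r j (≤-reflexive (sym i≡j)))
      d≡ : move k ≡ moveOf i r
      d≡ = cong (λ j → move (r * N + j)) (sym i≡j)
    ... | no i≢j = begin
      lookup (positions (r * N + suc j)) i   ≡⟨ cong (λ k → lookup (positions k) i) (+-suc (r * N) j) ⟩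
      lookup (positions (suc (r * N + j))) i ≡⟨ positions-other (r * N + j) i≢turn ⟩
      lookup (positions (r * N + j)) i       ≡⟨ positions-moved r j i<j (≤-trans (n≤1+n j) j<N) ⟩
      just (κ (state i r) (moveOf i r))      ∎
      where
      i<j : toℕ i < j
      i<j = ≤∧≢⇒< (s≤s⁻¹ i<1+j) i≢j
      i≢turn : i ≢ turn (r * N + j)
      i≢turn i≡turn = i≢j (trans (cong toℕ i≡turn) (turn-in-round r j j<N))

    state-initial : ∀ p → state p 0 ≡ nothing
    state-initial p = lookup-replicate p nothing

    state-next : ∀ p r → state p (suc r) ≡ just (κ (state p r) (moveOf p r))
    state-next p r = trans (cong (λ k → lookup (positions k) p) (+-comm N (r * N)))
                           (positions-moved r N (toℕ<n p) ≤-refl)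

    traceOf-isTrace : ∀ p → IsTrace K (traceOf p)
    traceOf-isTrace p = state p , (state-initial p , λ r → moveOf p r , state-next p r) , λ _ → refl

    state-blind : ∀ {p D} → σ p ≡ blind p D → ∀ r → state p r ≡ walk K D r
    state-blind {p} σp≡blind zero    = state-initial p
    state-blind {p} σp≡blind (suc r) =
      trans (state-next p r) (cong₂ (λ s d → just (κ s d)) (state-blind σp≡blind r) (moveOf-blind σp≡blind r))

    autState-wait : ∀ k → toℕ (turn k) ≢ 0 → autState (suc k) ≡ autState k
    autState-wait k turn≢0 with toℕ (turn k) ≟ 0
    ... | yes turn≡0 = contradiction turn≡0 turn≢0
    ... | no  _      = refl

    autState-read : ∀ k → toℕ (turn k) ≡ 0 →
                    autState (suc k) ≡ δ (autState k) (gLetter K Aψ N>0 (positions k))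
    autState-read k turn≡0 with toℕ (turn k) ≟ 0
    ... | yes _      = refl
    ... | no  turn≢0 = contradiction turn≡0 turn≢0

    autState-round    : ∀ r → autState (r * N) ≡ run word r
    autState-in-round : ∀ r j → suc j ≤ N → autState (r * N + suc j) ≡ run word (suc r)

    autState-round zero    = refl
    autState-round (suc r) = begin
      autState (N + r * N)             ≡⟨ cong autState (+-comm N (r * N)) ⟩
      autState (r * N + N)             ≡⟨ cong (λ j → autState (r * N + j)) (suc-pred N) ⟨
      autState (r * N + suc (pred N))  ≡⟨ autState-in-round r (pred N) (≤-reflexive (suc-pred N)) ⟩
      run word (suc r)                 ∎

    autState-in-round r zero _ = begin
      autState (r * N + 1)           ≡⟨ cong autState (+-comm (r * N) 1) ⟩
      autState (suc (r * N))         ≡⟨ autState-read (r * N) (trans (toℕ-turn (r * N)) (m*n%n≡0 r N)) ⟩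
      δ (autState (r * N)) (word r)  ≡⟨ cong (λ q → δ q (word r)) (autState-round r) ⟩
      run word (suc r)               ∎
    autState-in-round r (suc j) 2+j≤N = begin
      autState (r * N + suc (suc j))   ≡⟨ cong autState (+-suc (r * N) (suc j)) ⟩
      autState (suc (r * N + suc j))   ≡⟨ autState-wait (r * N + suc j) turn≢0 ⟩
      autState (r * N + suc j)         ≡⟨ autState-in-round r j (≤-trans (n≤1+n _) 2+j≤N) ⟩
      run word (suc r)                 ∎
      where
      turn≢0 : toℕ (turn (r * N + suc j)) ≢ 0
      turn≢0 turn≡0 = 0≢1+n (trans (sym turn≡0) (turn-in-round r (suc j) 2+j≤N))

    autState-later-round : ∀ k → ∃ λ r → k ≤ r * N × autState k ≡ run word r
    autState-later-round k = subst (λ k → ∃ λ r → k ≤ r * N × autState k ≡ run word r)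
                                   (sym k≡[k/N]*N+k%N) (within (k / N) (k % N) (m%n<n k N))
      where
      k≡[k/N]*N+k%N : k ≡ k / N * N + k % N
      k≡[k/N]*N+k%N = trans (m≡m%n+[m/n]*n k N) (+-comm (k % N) _)
      within : ∀ r j → j < N → ∃ λ r' → r * N + j ≤ r' * N × autState (r * N + j) ≡ run word r'
      within r zero    _   = r , ≤-reflexive (+-identityʳ (r * N)) ,
                               trans (cong autState (+-identityʳ (r * N))) (autState-round r)
      within r (suc j) 1+j<N =
        suc r , ≤-trans (+-monoʳ-≤ (r * N) (<⇒≤ 1+j<N)) (≤-reflexive (+-comm (r * N) N)) ,
        autState-in-round r j (<⇒≤ 1+j<N)

    Even⇔Accepts : Even (play σ) ⇔ Accepts word
    Even⇔Accepts = MinInfEven-cong (InfOften-slowdown N (λ r → cong c (autState-round r)) later)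
      where
      later : ∀ k → ∃ λ r → k ≤ r * N × c (autState k) ≡ c (run word r)
      later k = let r , k≤rN , same = autState-later-round k in r , k≤rN , cong c same

  module _ (n : ℕ) {σ σ' : Profile} (σ≡σ' : ∀ p → toℕ p < n → σ p ≡ σ' p) where
    private
      module A = Play σ
      module B = Play σ'

    record Agree (v v' : GVertex K Aψ N>0) : Set where
      constructor _,_
      field
        same-turn  : proj₂ (proj₂ v) ≡ proj₂ (proj₂ v')
        same-below : ∀ i → toℕ i < n → lookup (proj₁ v) i ≡ lookup (proj₁ v') i
    open Agree

    Agree⇒∼ : ∀ {p v v'} → toℕ p < n → Agree v v' → gSim K Aψ N>0 v p v'
    Agree⇒∼ p<n v≈v' = same-turn v≈v' , λ j j≤p → same-below v≈v' j (≤-<-trans j≤p p<n)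

    move-agree : ∀ k → Pointwise Agree (A.past k) (B.past k) → Agree (play σ k) (play σ' k) →
                 toℕ (A.turn k) < n → A.move k ≡ B.move k
    move-agree k past≈ now≈ p<n = begin
      proj₁ (σ p) (A.past k) (play σ k)   ≡⟨ cong (λ s → proj₁ s (A.past k) (play σ k)) (σ≡σ' p p<n) ⟩
      proj₁ (σ' p) (A.past k) (play σ k)  ≡⟨ proj₂ (σ' p) _ _ _ _ refl (sym (same-turn now≈))
                                                (Pointwise.map (Agree⇒∼ p<n) past≈) (Agree⇒∼ p<n now≈) ⟩
      proj₁ (σ' p) (B.past k) (play σ' k) ≡⟨ cong (λ q → proj₁ (σ' q) (B.past k) (play σ' k)) (same-turn now≈) ⟩
      B.move k                            ∎
      where
      p : Fin N
      p = A.turn k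

    -- Players below n observe only positions below n, which the other players never move.
    plays-agree : ∀ k → Pointwise Agree (A.past k) (B.past k) × Agree (play σ k) (play σ' k)
    plays-agree zero    = [] , (refl , λ _ _ → refl)
    plays-agree (suc k) =
      ++⁺ past≈ (now≈ ∷ []) ,
      (cong (nxt K Aψ N>0) (same-turn now≈) ,
       lookup∘update-agree (λ i → toℕ i < n) {A.positions k} {B.positions k}
                           (same-turn now≈) moved-alike (same-below now≈))
      where
      past≈ : Pointwise Agree (A.past k) (B.past k)
      past≈ = proj₁ (plays-agree k)
      now≈ : Agree (play σ k) (play σ' k)
      now≈ = proj₂ (plays-agree k)
      moved-alike : toℕ (A.turn k) < n →
                    just (κ (lookup (A.positions k) (A.turn k)) (A.move k)) ≡
                    just (κ (lookup (B.positions k) (B.turn k)) (B.move k))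
      moved-alike p<n = cong₂ (λ s d → just (κ s d))
                              (trans (same-below now≈ (A.turn k) p<n) (cong (lookup (B.positions k)) (same-turn now≈)))
                              (move-agree k past≈ now≈ p<n)

    state-agree : ∀ p → toℕ p < n → ∀ r → A.state p r ≡ B.state p r
    state-agree p p<n r = same-below (proj₂ (plays-agree (r * N))) p p<n

module _ {nAP} (K : Kripke nAP) (n m : ℕ) (N>0 : 0 < n + m) (Aψ : DPA (Letter (n + m) nAP)) where
  open Kripke K using (nD; ℓ)
  open MPG (Game K Aψ N>0) using (Strategy; pick; play; Even; Wins; vinit)

  coalition : ((p : Fin (n + m)) → T (ℙ∃ n p) → Strategy p) →
              ((p : Fin (n + m)) → T (not (ℙ∃ n p)) → Strategy p) → Profile K Aψ N>0
  coalition σA σB p = pick (ℙ∃ n p) (σA p) (σB p)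

  pick-yes : ∀ {X A : Set} (a? : Dec A) (f : T ⌊ a? ⌋ → X) g (a : A) →
             pick ⌊ a? ⌋ f g ≡ f (fromWitness a)
  pick-yes (yes _) f g a = refl
  pick-yes (no ¬a) f g a = contradiction a ¬a

  pick-no : ∀ {X A : Set} (a? : Dec A) f (g : T (not ⌊ a? ⌋) → X) (¬a : ¬ A) →
            pick ⌊ a? ⌋ f g ≡ g (fromWitnessFalse ¬a)
  pick-no (yes a) f g ¬a = contradiction a ¬a
  pick-no (no _)  f g ¬a = refl

  coalition-∃ : ∀ σA σB {p} (p<n : toℕ p < n) → coalition σA σB p ≡ σA p (fromWitness p<n)
  coalition-∃ σA σB {p} = pick-yes (toℕ p <? n) (σA p) (σB p)

  coalition-∀ : ∀ σA σB {p} (p≮n : ¬ toℕ p < n) → coalition σA σB p ≡ σB p (fromWitnessFalse p≮n)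
  coalition-∀ σA σB {p} = pick-no (toℕ p <? n) (σA p) (σB p)

  module _ (ψ : LTL (n + m) nAP) (recognizes : Recognizes Aψ ψ) where
    wins⇒∃∀-Sat : Wins (ℙ∃ n) → ∃∀-Sat K n m ψ
    wins⇒∃∀-Sat (σA , σA-wins) = ts₁ , tabulate⁺ existential-trace-isTrace , universal
      where
      -- Blind opponents need some direction (K may have none); existential player i supplies one.
      fixed-opponents : Fin n → (p : Fin (n + m)) → T (not (ℙ∃ n p)) → Strategy p
      fixed-opponents i p _ = blind K Aψ N>0 p (λ _ → proj₁ (σA (i ↑ˡ m) i∃) [] vinit)
        where
        i∃ : T (ℙ∃ n (i ↑ˡ m))
        i∃ = fromWitness (subst (_< n) (sym (toℕ-↑ˡ i m)) (toℕ<n i))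

      profile₀ : Fin n → Profile K Aψ N>0
      profile₀ i = coalition σA (fixed-opponents i)

      existential-trace : Fin n → Trace nAP
      existential-trace i = Play.traceOf K Aψ N>0 (profile₀ i) (i ↑ˡ m)

      existential-trace-isTrace : ∀ i → IsTrace K (existential-trace i)
      existential-trace-isTrace i = Play.traceOf-isTrace K Aψ N>0 (profile₀ i) (i ↑ˡ m)

      ts₁ : Vec (Trace nAP) n
      ts₁ = tabulate existential-trace

      universal : ∀ ts₂ → All (IsTrace K) ts₂ → zipTraces (ts₁ ++ ts₂) , 0 ⊨ ψ
      universal ts₂ ts₂-traces =
        ⊨-cong matches ψ 0 (proj₁ (recognizes word) (to Even⇔Accepts (σA-wins σB)))
        where
        D₂ : Fin m → ℕ → Fin nD
        D₂ j = proj₁ (trace⇒walk K (lookup⁺ ts₂-traces j))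

        σB : (p : Fin (n + m)) → T (not (ℙ∃ n p)) → Strategy p
        σB p p∀ = blind K Aψ N>0 p (D₂ (reduce≥ p (≮⇒≥ (toWitnessFalse p∀))))

        open Play K Aψ N>0 (coalition σA σB)

        matches : ∀ r p → word r p ≡ zipTraces (ts₁ ++ ts₂) r p
        matches r p with toℕ p <? n
        ... | yes p<n = begin
          ℓ (state p r)                        ≡⟨ cong ℓ (state-agree K Aψ N>0 n σ≡σ₀ p p<n r) ⟩
          Play.traceOf K Aψ N>0 σ₀ p r         ≡⟨ cong (λ q → Play.traceOf K Aψ N>0 σ₀ q r) (fromℕ<-↑ˡ m p<n) ⟨
          Play.traceOf K Aψ N>0 σ₀ (i ↑ˡ m) r  ≡⟨ cong (λ t → t r) (lookup∘tabulate existential-trace i) ⟨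
          lookup ts₁ i r                       ≡⟨ cong (λ t → t r) (lookup-++-< ts₁ ts₂ p p<n) ⟨
          lookup (ts₁ ++ ts₂) p r              ∎
          where
          i : Fin n
          i = fromℕ< p<n
          σ₀ : Profile K Aψ N>0
          σ₀ = profile₀ i
          σ≡σ₀ : ∀ q → toℕ q < n → coalition σA σB q ≡ σ₀ q
          σ≡σ₀ q q<n = trans (coalition-∃ σA σB q<n) (sym (coalition-∃ σA (fixed-opponents i) q<n))
        ... | no p≮n = begin
          ℓ (state p r)                        ≡⟨ cong ℓ (state-blind (coalition-∀ σA σB p≮n) r) ⟩
          ℓ (walk K (D₂ j) r)                  ≡⟨ proj₂ (trace⇒walk K (lookup⁺ ts₂-traces j)) r ⟨
          lookup ts₂ j r                       ≡⟨ cong (λ t → t r) (lookup-++-≥ ts₁ ts₂ p (≮⇒≥ p≮n)) ⟨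
          lookup (ts₁ ++ ts₂) p r              ∎
          where
          j : Fin m
          j = reduce≥ p (≮⇒≥ p≮n)

    ∃∀-Sat⇒wins : ∃∀-Sat K n m ψ → Wins (ℙ∃ n)
    ∃∀-Sat⇒wins (ts₁ , ts₁-traces , universal) = σA , σA-wins
      where
      D₁ : Fin n → ℕ → Fin nD
      D₁ i = proj₁ (trace⇒walk K (lookup⁺ ts₁-traces i))

      σA : (p : Fin (n + m)) → T (ℙ∃ n p) → Strategy p
      σA p p∃ = blind K Aψ N>0 p (D₁ (fromℕ< (toWitness p∃)))

      σA-wins : (σB : (p : Fin (n + m)) → T (not (ℙ∃ n p)) → Strategy p) → Even (play (coalition σA σB))
      σA-wins σB = from Even⇔Accepts (proj₂ (recognizes word) (⊨-cong matches ψ 0 (universal ts₂ ts₂-traces)))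
        where
        open Play K Aψ N>0 (coalition σA σB)

        ts₂ : Vec (Trace nAP) m
        ts₂ = drop n (tabulate traceOf)

        ts₂-traces : All (IsTrace K) ts₂
        ts₂-traces = drop⁺ n (tabulate⁺ traceOf-isTrace)

        matches : ∀ r p → zipTraces (ts₁ ++ ts₂) r p ≡ word r p
        matches r p with toℕ p <? n
        ... | yes p<n = begin
          lookup (ts₁ ++ ts₂) p r        ≡⟨ cong (λ t → t r) (lookup-++-< ts₁ ts₂ p p<n) ⟩
          lookup ts₁ i r                 ≡⟨ proj₂ (trace⇒walk K (lookup⁺ ts₁-traces i)) r ⟩
          ℓ (walk K (D₁ i) r)            ≡⟨ cong ℓ (state-blind (coalition-∃ σA σB p<n) r) ⟨
          ℓ (state p r)                  ∎
          where
          i : Fin n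
          i = fromℕ< p<n
        ... | no p≮n = begin
          lookup (ts₁ ++ ts₂) p r        ≡⟨ cong (λ t → t r) (lookup-++-drop ts₁ (tabulate traceOf) p (≮⇒≥ p≮n)) ⟩
          lookup (tabulate traceOf) p r  ≡⟨ cong (λ t → t r) (lookup∘tabulate traceOf p) ⟩
          traceOf p r                    ∎

theorem2 : ∀ {nAP} (K : Kripke nAP) (n m : ℕ) (N>0 : 0 < n + m)
             (ψ : LTL (n + m) nAP) (Aψ : DPA (Letter (n + m) nAP)) →
             Recognizes Aψ ψ →
             MPG.Wins (Game K Aψ N>0) (ℙ∃ n) ⇔ (K ⊨ᴴ ∃∀-formula n m ψ)
theorem2 K n m N>0 ψ Aψ recognizes =
  ⇔.trans (mk⇔ (wins⇒∃∀-Sat K n m N>0 Aψ ψ recognizes) (∃∀-Sat⇒wins K n m N>0 Aψ ψ recognizes))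
          (⇔.sym (⊨-∃∀ K n m ψ))
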